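{- Every graph that has exactly one component containing an edge, this component being a double vase (all other components being isolated vertices), is line $[B,-]$-nice.
   Context: For $n\in\mathbb N$, a double vase of $n$ flowers has vertices $v,x_1,x_2,y_1,y_2,w_1,\dots,w_n$ and edges $vx_1,x_1x_2,x_2v,vy_1,y_1y_2,y_2v$ and $vw_j$ ($1\le j\le n$). In the $[B,-]$-edge colouring game with $k$ colours, Bob and Alice alternately colour a previously uncoloured edge with one of $k$ colours so that edges sharing an endpoint get distinct colours; Bob moves first; no player may skip. The game ends when no move is possible; Alice wins iff all edges are coloured. A graph $G$ is line $[B,-]$-nice if the least $k$ for which Alice has a winning strategy equals $\omega(L(G))$, the maximum number of pairwise adjacent edges of $G$. -}

module Defs where

open import Data.Nat using (ℕ; zero; suc; _<_; _<ᵇ_)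
open import Data.Fin using (Fin; toℕ; _≟_)
open import Data.Bool using (Bool; true; false; _∨_; _∧_; if_then_else_)
open import Data.Bool.Properties using (∨-comm)
open import Data.Maybe using (Maybe; just; nothing)
open import Data.Product using (Σ; _×_; _,_; ∃)
open import Data.Sum using (_⊎_)
open import Data.List using (List; length)
open import Data.List.Relation.Unary.All using (All)
open import Data.List.Relation.Unary.AllPairs using (AllPairs)
open import Relation.Binary.PropositionalEquality using (_≡_; _≢_; refl)
open import Relation.Nullary using (¬_)
open import Relation.Nullary.Decidable using (⌊_⌋)
open import Function.Bundles using (_↔_; Inverse)

record Graph : Set where
  field
    N      : ℕ
    Adj    : Fin N → Fin N → Bool
    sym    : ∀ u v → Adj u v ≡ Adj v u
    irrefl : ∀ u → Adj u u ≡ false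
open Graph public

_≅_ : Graph → Graph → Set
G ≅ H = Σ (Fin (N G) ↔ Fin (N H)) λ f →
          ∀ u v → Adj G u v ≡ Adj H (Inverse.to f u) (Inverse.to f v)

-- Clique number of the line graph, ω(L(G)):
-- the maximum number of pairwise adjacent (distinct) edges of G.
-- An edge is represented by an ordered pair (u , v) with u < v and Adj u v.

IsEdge : (G : Graph) → Fin (N G) × Fin (N G) → Set
IsEdge G (u , v) = (toℕ u < toℕ v) × (Adj G u v ≡ true)

ShareEnd : {A : Set} → A × A → A × A → Set
ShareEnd (a , b) (c , d) = (a ≡ c) ⊎ (a ≡ d) ⊎ (b ≡ c) ⊎ (b ≡ d)

IsLineClique : (G : Graph) → List (Fin (N G) × Fin (N G)) → Set
IsLineClique G es =
  All (IsEdge G) es × AllPairs (λ e f → (e ≢ f) × ShareEnd e f) es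

IsLineCliqueNumber : Graph → ℕ → Set
IsLineCliqueNumber G w =
  (Σ (List (Fin (N G) × Fin (N G))) λ es → IsLineClique G es × length es ≡ w)
  × (∀ es → IsLineClique G es → length es Data.Nat.≤ w)

-- The [B,-]-edge colouring game with k colours.
-- A position stores colours symmetrically: c u v = c v u is the colour
-- of the edge uv (nothing = uncoloured).

Colouring : Graph → ℕ → Set
Colouring G k = Fin (N G) → Fin (N G) → Maybe (Fin k)

Legal : (G : Graph) {k : ℕ} → Colouring G k → Fin (N G) → Fin (N G) → Fin k → Set
Legal G c u v col =
  (Adj G u v ≡ true) × (c u v ≡ nothing)
  × (∀ w → c u w ≢ just col) × (∀ w → c v w ≢ just col)

paint : (G : Graph) {k : ℕ} → Colouring G k → Fin (N G) → Fin (N G) → Fin k → Colouring G k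
paint G c u v col x y =
  if (⌊ x ≟ u ⌋ ∧ ⌊ y ≟ v ⌋) ∨ (⌊ x ≟ v ⌋ ∧ ⌊ y ≟ u ⌋) then just col else c x y

AllColoured : (G : Graph) {k : ℕ} → Colouring G k → Set
AllColoured G c = ∀ u v → Adj G u v ≡ true → c u v ≢ nothing

data Player : Set where
  alice bob : Player

-- AliceWins G k p c : Alice has a winning strategy from position c
-- when player p is to move.  (The game is finite, so an inductive
-- winning-strategy predicate is the right notion.)  The game ends when
-- no legal move exists; Alice wins iff all edges are coloured then.
data AliceWins (G : Graph) (k : ℕ) : Player → Colouring G k → Set where
  finished  : ∀ {p c} → AllColoured G c → AliceWins G k p c
  aliceMove : ∀ {c} u v col → Legal G c u v col →
              AliceWins G k bob (paint G c u v col) → AliceWins G k alice c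
  bobMove   : ∀ {c} →
              (Σ (Fin (N G)) λ u → Σ (Fin (N G)) λ v → Σ (Fin k) λ col → Legal G c u v col) →
              (∀ u v col → Legal G c u v col → AliceWins G k alice (paint G c u v col)) →
              AliceWins G k bob c

AliceWinsB : Graph → ℕ → Set
AliceWinsB G k = AliceWins G k bob (λ _ _ → nothing)

LineBNice : Graph → Set
LineBNice G = Σ ℕ λ w → IsLineCliqueNumber G w ×
  (AliceWinsB G w × (∀ k → k < w → ¬ AliceWinsB G k))

-- Vertex numbering: 0 = v, 1 = x₁, 2 = x₂, 3 = y₁, 4 = y₂,
-- 5 + j = w_{j+1} (j < n), and vertices 5 + n , … , 4 + n + m are isolated.

dvE : ℕ → ℕ → ℕ → Bool
dvE n 0 1 = true
dvE n 1 2 = true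
dvE n 0 2 = true
dvE n 0 3 = true
dvE n 3 4 = true
dvE n 0 4 = true
dvE n 0 (suc (suc (suc (suc (suc j))))) = j <ᵇ n
dvE n _ _ = false

dvAdj : ℕ → ℕ → ℕ → Bool
dvAdj n a b = dvE n a b ∨ dvE n b a

dvE-irr : ∀ n a → dvE n a a ≡ false
dvE-irr n 0 = refl
dvE-irr n 1 = refl
dvE-irr n 2 = refl
dvE-irr n 3 = refl
dvE-irr n 4 = refl
dvE-irr n (suc (suc (suc (suc (suc j))))) = refl

DoubleVasePlusIsolated : ℕ → ℕ → Graph
DoubleVasePlusIsolated n m = record
  { N      = 5 Data.Nat.+ n Data.Nat.+ m
  ; Adj    = λ a b → dvAdj n (toℕ a) (toℕ b)
  ; sym    = λ a b → ∨-comm (dvE n (toℕ a) (toℕ b)) (dvE n (toℕ b) (toℕ a))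
  ; irrefl = λ a → irr (toℕ a)
  }
  where
  irr : ∀ x → dvAdj n x x ≡ false
  irr x rewrite dvE-irr n x = refl

-- The hub v of the double vase has degree 4 + n, which gives both lower bounds: its spokes form a
-- clique of L(G), and no proper edge colouring with fewer colours is complete, so Alice cannot win.
-- Conversely, giving each spoke its own colour and each rim the colour of a spoke of the other
-- triangle is a proper edge colouring with 4 + n colours, which bounds ω(L(G)).
--
-- With 4 + n colours Alice wins by securing both triangles: a triangle is secure once its rim colour
-- occurs at v or both its spokes are coloured. Security survives every move, and while both
-- triangles are secure every uncoloured edge has a free colour (a rim sees at most two colours, a
-- spoke only colours present at v, which still has an uncoloured spoke), so the play ends with all
-- edges coloured whatever either player does. Alice secures one triangle with her first move (if Bob
-- coloured a rim, she repeats his colour on a spoke of the other triangle; if a spoke, on a rim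
-- avoiding it) and the other triangle with her second.
module Submission where

open import Defs hiding (sym)
open import Data.Bool using (Bool; true; false; not) renaming (T to True)
open import Data.Bool.Properties using (¬-not; ∨-identityʳ; T-≡; T-∨) renaming (_≟_ to _≟ᵇ_)
open import Data.Empty using (⊥-elim)
open import Data.Fin using (Fin; zero; suc; toℕ; fromℕ<; punchOut; _≟_)
open import Data.Fin.Properties
  using (any?; injective⇒≤; punchOut-injective; toℕ-injective; toℕ-fromℕ<; toℕ<n)
open import Data.List using (List; []; _∷_; length; lookup; allFin; cartesianProduct; tabulate)
open import Data.List.Properties using (length-tabulate)
open import Data.List.Membership.Propositional using (_∈_)
open import Data.List.Membership.Propositional.Properties
  using (∈-lookup; ∈-allFin; ∈-cartesianProduct⁺)
import Data.List.Relation.Unary.All as All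
open All using (All; []; _∷_)
open import Data.List.Relation.Unary.All.Properties using () renaming (tabulate⁺ to All-tabulate⁺)
open import Data.List.Relation.Unary.AllPairs using (AllPairs; []; _∷_)
open import Data.List.Relation.Unary.AllPairs.Properties using () renaming (tabulate⁺ to AllPairs-tabulate⁺)
open import Data.List.Relation.Unary.Any using (here; there)
open import Data.Maybe using (Maybe; just; nothing)
open import Data.Maybe.Properties using (just-injective) renaming (≡-dec to ≡-dec-Maybe)
open import Data.Nat using (ℕ; zero; suc; _+_; _≤_; _<_; _<ᵇ_; z≤n; s≤s)
open import Data.Nat.Induction using (<-wellFounded)
open import Data.Nat.Properties
  using ( suc-injective; m≤m+n; <ᵇ⇒<; <⇒<ᵇ; n<1+n; ≤-refl; ≤-trans
        ; +-mono-≤; +-mono-<-≤; +-mono-≤-<; <⇒≱; <-cmp; <-asym)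
open import Data.Product using (Σ; ∃; ∃₂; _×_; _,_; proj₁; proj₂)
open import Data.Sum using (_⊎_; inj₁; inj₂)
open import Function using (_∘_; case_of_)
open import Function.Bundles using (Equivalence; Inverse)
open import Function.Definitions using (Injective)
open import Induction.WellFounded using (Acc; acc)
open import Relation.Binary.Definitions using (tri<; tri≈; tri>)
open import Relation.Binary.PropositionalEquality
  using (_≡_; _≢_; refl; sym; trans; cong; subst; subst₂; ≢-sym)
open import Relation.Nullary using (¬_; Dec; yes; no; contradiction)
open import Relation.Nullary.Decidable using (_×-dec_; ¬?)

private variable
  k : ℕ
  A : Set

distinct⇒length≤ : {xs : List (Fin k)} → AllPairs _≢_ xs → length xs ≤ k
distinct⇒length≤ ps = injective⇒≤ (lookup-injective ps)
  where
  lookup-injective : ∀ {ys : List (Fin k)} → AllPairs _≢_ ys → Injective _≡_ _≡_ (lookup ys)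
  lookup-injective (p ∷ ps) {zero}  {zero}  _ = refl
  lookup-injective (p ∷ ps) {zero}  {suc j} e = contradiction e (All.lookup p (∈-lookup j))
  lookup-injective (p ∷ ps) {suc i} {zero}  e = contradiction (sym e) (All.lookup p (∈-lookup i))
  lookup-injective (p ∷ ps) {suc i} {suc j} e = cong suc (lookup-injective ps e)

two-values⇒≤2 : ∀ {m₁ m₂ : Maybe (Fin k)} → (∀ a → m₁ ≡ just a ⊎ m₂ ≡ just a) →
                k ≤ 2
two-values⇒≤2 {k} {m₁} {m₂} h = injective⇒≤ side-injective
  where
  side : ∀ {a} → m₁ ≡ just a ⊎ m₂ ≡ just a → Fin 2
  side (inj₁ _) = zero
  side (inj₂ _) = suc zero
  side-injective : Injective _≡_ _≡_ (λ a → side (h a))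
  side-injective {a} {b} with h a | h b
  ... | inj₁ p | inj₁ q = λ _ → just-injective (trans (sym p) q)
  ... | inj₂ p | inj₂ q = λ _ → just-injective (trans (sym p) q)
  ... | inj₁ _ | inj₂ _ = λ ()
  ... | inj₂ _ | inj₁ _ = λ ()

≡just⇒≢nothing : ∀ {m : Maybe A} {a} → m ≡ just a → m ≢ nothing
≡just⇒≢nothing refl ()

≢nothing⇒≡just : ∀ {m : Maybe A} → m ≢ nothing → ∃ λ a → m ≡ just a
≢nothing⇒≡just {m = just a}  _  = a , refl
≢nothing⇒≡just {m = nothing} ne = contradiction refl ne

¬≢nothing : ∀ {m : Maybe A} → ¬ (m ≢ nothing) → m ≡ nothing
¬≢nothing {m = just _}  h = contradiction (λ ()) h
¬≢nothing {m = nothing} _ = refl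

module Edges (G : Graph) where

  Vertex : Set
  Vertex = Fin (N G)

  private variable
    u w x y p q : Vertex

  SameEdge : Vertex → Vertex → Vertex → Vertex → Set
  SameEdge x y u w = (x ≡ u × y ≡ w) ⊎ (x ≡ w × y ≡ u)

  ¬SameEdge : x ≢ u ⊎ y ≢ w → x ≢ w ⊎ y ≢ u → ¬ SameEdge x y u w
  ¬SameEdge (inj₁ x≢u) _          (inj₁ (x≡u , _)) = x≢u x≡u
  ¬SameEdge (inj₂ y≢w) _          (inj₁ (_ , y≡w)) = y≢w y≡w
  ¬SameEdge _          (inj₁ x≢w) (inj₂ (x≡w , _)) = x≢w x≡w
  ¬SameEdge _          (inj₂ y≢u) (inj₂ (_ , y≡u)) = y≢u y≡u

  SameEdge-reverse : SameEdge x y u w → SameEdge y x u w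
  SameEdge-reverse (inj₁ (e₁ , e₂)) = inj₂ (e₂ , e₁)
  SameEdge-reverse (inj₂ (e₁ , e₂)) = inj₁ (e₂ , e₁)

  SameEdge-sym : SameEdge x y u w → SameEdge u w x y
  SameEdge-sym (inj₁ (refl , refl)) = inj₁ (refl , refl)
  SameEdge-sym (inj₂ (refl , refl)) = inj₂ (refl , refl)

  SameEdge-trans : SameEdge x y u w → SameEdge u w p q → SameEdge x y p q
  SameEdge-trans (inj₁ (refl , refl)) s = s
  SameEdge-trans (inj₂ (refl , refl)) s = SameEdge-reverse s

  oriented-unique : ∀ {x′ y′} → SameEdge x y u w → SameEdge x′ y′ u w →
                    toℕ x < toℕ y → toℕ x′ < toℕ y′ → (x , y) ≡ (x′ , y′)
  oriented-unique (inj₁ (refl , refl)) (inj₁ (refl , refl)) _ _  = refl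
  oriented-unique (inj₂ (refl , refl)) (inj₂ (refl , refl)) _ _  = refl
  oriented-unique (inj₁ (refl , refl)) (inj₂ (refl , refl)) l l′ = contradiction l′ (<-asym l)
  oriented-unique (inj₂ (refl , refl)) (inj₁ (refl , refl)) l l′ = contradiction l′ (<-asym l)

  Oriented : Vertex → Vertex → Set
  Oriented x y = ∃ λ e → toℕ (proj₁ e) < toℕ (proj₂ e) × SameEdge (proj₁ e) (proj₂ e) x y

  orient : ∀ x y → x ≢ y → Oriented x y
  orient x y x≢y with <-cmp (toℕ x) (toℕ y)
  ... | tri< x<y _ _ = (x , y) , x<y , inj₁ (refl , refl)
  ... | tri≈ _ x≡y _ = contradiction (toℕ-injective x≡y) x≢y
  ... | tri> _ _ y<x = (y , x) , y<x , inj₂ (refl , refl)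

  ShareEnd-sym : ∀ {e e′ : Vertex × Vertex} → ShareEnd e e′ → ShareEnd e′ e
  ShareEnd-sym (inj₁ e)               = inj₁ (sym e)
  ShareEnd-sym (inj₂ (inj₁ e))        = inj₂ (inj₂ (inj₁ (sym e)))
  ShareEnd-sym (inj₂ (inj₂ (inj₁ e))) = inj₂ (inj₁ (sym e))
  ShareEnd-sym (inj₂ (inj₂ (inj₂ e))) = inj₂ (inj₂ (inj₂ (sym e)))

  ShareEnd-respˡ : SameEdge x y u w → ShareEnd (x , y) (p , q) → ShareEnd (u , w) (p , q)
  ShareEnd-respˡ (inj₁ (refl , refl)) sh = sh
  ShareEnd-respˡ (inj₂ (refl , refl)) (inj₁ e)               = inj₂ (inj₂ (inj₁ e))
  ShareEnd-respˡ (inj₂ (refl , refl)) (inj₂ (inj₁ e))        = inj₂ (inj₂ (inj₂ e))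
  ShareEnd-respˡ (inj₂ (refl , refl)) (inj₂ (inj₂ (inj₁ e))) = inj₁ e
  ShareEnd-respˡ (inj₂ (refl , refl)) (inj₂ (inj₂ (inj₂ e))) = inj₂ (inj₁ e)

  SameEdge⇒ShareEnd : SameEdge x y u w → ShareEnd (x , y) (u , w)
  SameEdge⇒ShareEnd (inj₁ (refl , _)) = inj₁ refl
  SameEdge⇒ShareEnd (inj₂ (refl , _)) = inj₂ (inj₁ refl)

  ShareEnd-resp : ∀ {r s} → SameEdge x y u w → SameEdge p q r s →
                  ShareEnd (x , y) (p , q) → ShareEnd (u , w) (r , s)
  ShareEnd-resp s s′ = ShareEnd-sym ∘ ShareEnd-respˡ s′ ∘ ShareEnd-sym ∘ ShareEnd-respˡ s

  adjacent-distinct : Adj G x y ≡ true → x ≢ y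
  adjacent-distinct {x} adj refl = contradiction (trans (sym adj) (irrefl G x)) λ ()

  adjacent-resp : SameEdge x y u w → Adj G u w ≡ true → Adj G x y ≡ true
  adjacent-resp (inj₁ (refl , refl)) adj = adj
  adjacent-resp {x} {y} (inj₂ (refl , refl)) adj = trans (Graph.sym G x y) adj

  record Star (x : Vertex) (d : ℕ) : Set where
    field
      leaf           : Fin d → Vertex
      leaf-injective : Injective _≡_ _≡_ leaf
      leaf-adjacent  : ∀ i → Adj G x (leaf i) ≡ true

  star⇒lineClique : ∀ {d} → Star x d →
                    Σ (List (Vertex × Vertex)) λ es → IsLineClique G es × length es ≡ d
  star⇒lineClique {x} {d} star =
    tabulate edge , (All-tabulate⁺ isEdge , AllPairs-tabulate⁺ adjacent) , length-tabulate edge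
    where
    open Star star
    oriented : ∀ i → Oriented x (leaf i)
    oriented i = orient x (leaf i) (adjacent-distinct (leaf-adjacent i))
    edge : Fin d → Vertex × Vertex
    edge i = proj₁ (oriented i)
    through : ∀ i → SameEdge (proj₁ (edge i)) (proj₂ (edge i)) x (leaf i)
    through i = proj₂ (proj₂ (oriented i))
    isEdge : ∀ i → IsEdge G (edge i)
    isEdge i = proj₁ (proj₂ (oriented i)) , adjacent-resp (through i) (leaf-adjacent i)
    leaf-unique : ∀ {p q y y′} → x ≢ y → SameEdge p q x y → SameEdge p q x y′ → y ≡ y′
    leaf-unique _   (inj₁ (refl , refl)) (inj₁ (_ , refl)) = refl
    leaf-unique x≢y (inj₁ (refl , refl)) (inj₂ (_ , refl)) = contradiction refl x≢y
    leaf-unique x≢y (inj₂ (refl , refl)) (inj₁ (refl , _)) = contradiction refl x≢y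
    leaf-unique _   (inj₂ (refl , refl)) (inj₂ (refl , _)) = refl
    share-centre : ∀ {p q r s y y′} → SameEdge p q x y → SameEdge r s x y′ → ShareEnd (p , q) (r , s)
    share-centre (inj₁ (refl , _)) (inj₁ (refl , _)) = inj₁ refl
    share-centre (inj₁ (refl , _)) (inj₂ (_ , refl)) = inj₂ (inj₁ refl)
    share-centre (inj₂ (_ , refl)) (inj₁ (refl , _)) = inj₂ (inj₂ (inj₁ refl))
    share-centre (inj₂ (_ , refl)) (inj₂ (_ , refl)) = inj₂ (inj₂ (inj₂ refl))
    adjacent : ∀ {i j} → i ≢ j → edge i ≢ edge j × ShareEnd (edge i) (edge j)
    adjacent {i} {j} i≢j =
      (λ e → i≢j (leaf-injective (leaf-unique (adjacent-distinct (leaf-adjacent i)) (through i)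
                   (subst (λ e → SameEdge (proj₁ e) (proj₂ e) x (leaf j)) (sym e) (through j)))))
      , share-centre (through i) (through j)

  record ProperEdgeColouring (k : ℕ) : Set where
    field
      colour : ∀ {e} → IsEdge G e → Fin k
      proper : ∀ {e e′} (ie : IsEdge G e) (ie′ : IsEdge G e′) → e ≢ e′ → ShareEnd e e′ →
               colour ie ≢ colour ie′

  lineClique-length≤ : ProperEdgeColouring k → ∀ {es} → IsLineClique G es → length es ≤ k
  lineClique-length≤ {k} χ (ies , pairs) =
    subst (_≤ k) (length-colours ies) (distinct⇒length≤ (distinct ies pairs))
    where
    open ProperEdgeColouring χ
    colours : ∀ {es} → All (IsEdge G) es → List (Fin k)
    colours []         = []
    colours (ie ∷ ies) = colour ie ∷ colours ies
    length-colours : ∀ {es} (ies : All (IsEdge G) es) → length (colours ies) ≡ length es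
    length-colours []        = refl
    length-colours (_ ∷ ies) = cong suc (length-colours ies)
    distinct-from : ∀ {e es} (ie : IsEdge G e) (ies : All (IsEdge G) es) →
                    All (λ e′ → e ≢ e′ × ShareEnd e e′) es → All (colour ie ≢_) (colours ies)
    distinct-from ie []          []                 = []
    distinct-from ie (ie′ ∷ ies) ((ne , sh) ∷ rest) = proper ie ie′ ne sh ∷ distinct-from ie ies rest
    distinct : ∀ {es} (ies : All (IsEdge G) es) →
               AllPairs (λ e e′ → e ≢ e′ × ShareEnd e e′) es → AllPairs _≢_ (colours ies)
    distinct []         []           = []
    distinct (ie ∷ ies) (ps ∷ pairs) = distinct-from ie ies ps ∷ distinct ies pairs

module Positions (G : Graph) {k : ℕ} where

  open Edges G

  private variable
    u w x y p q : Vertex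
    c : Colouring G k
    a b col : Fin k

  paint-cases : ∀ (c : Colouring G k) u w col x y →
                (SameEdge x y u w × paint G c u w col x y ≡ just col)
                ⊎ (¬ SameEdge x y u w × paint G c u w col x y ≡ c x y)
  paint-cases c u w col x y with x ≟ u | y ≟ w | x ≟ w | y ≟ u
  ... | yes a | yes b | _     | _     = inj₁ (inj₁ (a , b) , refl)
  ... | yes _ | no _  | yes d | yes e = inj₁ (inj₂ (d , e) , refl)
  ... | no _  | _     | yes d | yes e = inj₁ (inj₂ (d , e) , refl)
  ... | yes _ | no b  | yes _ | no e  = inj₂ (¬SameEdge (inj₂ b) (inj₂ e) , refl)
  ... | yes _ | no b  | no d  | _     = inj₂ (¬SameEdge (inj₂ b) (inj₁ d) , refl)
  ... | no a  | _     | yes _ | no e  = inj₂ (¬SameEdge (inj₁ a) (inj₂ e) , refl)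
  ... | no a  | _     | no d  | _     = inj₂ (¬SameEdge (inj₁ a) (inj₁ d) , refl)

  paint-same : SameEdge x y u w → paint G c u w col x y ≡ just col
  paint-same {x} {y} {u} {w} {c} {col} s with paint-cases c u w col x y
  ... | inj₁ (_ , e)  = e
  ... | inj₂ (¬s , _) = contradiction s ¬s

  paint-here : ∀ (c : Colouring G k) u w col → paint G c u w col u w ≡ just col
  paint-here c u w col = paint-same {c = c} (inj₁ (refl , refl))

  paint-other : ¬ SameEdge x y u w → paint G c u w col x y ≡ c x y
  paint-other {x} {y} {u} {w} {c} {col} ¬s with paint-cases c u w col x y
  ... | inj₁ (s , _) = contradiction s ¬s
  ... | inj₂ (_ , e) = e

  paint-just : paint G c u w col x y ≡ just b → (SameEdge x y u w × b ≡ col) ⊎ c x y ≡ just b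
  paint-just {c} {u} {w} {col} {x} {y} e with paint-cases c u w col x y
  ... | inj₁ (s , e′) = inj₁ (s , just-injective (trans (sym e) e′))
  ... | inj₂ (_ , e′) = inj₂ (trans (sym e′) e)

  paint-coloured : paint G c u w col x y ≢ nothing → SameEdge x y u w ⊎ c x y ≢ nothing
  paint-coloured {c} {u} {w} {col} {x} {y} ne with paint-cases c u w col x y
  ... | inj₁ (s , _) = inj₁ s
  ... | inj₂ (_ , e) = inj₂ λ e′ → ne (trans e e′)

  Symmetric : Colouring G k → Set
  Symmetric c = ∀ x y → c x y ≡ c y x

  Supported : Colouring G k → Set
  Supported c = ∀ x y → c x y ≢ nothing → Adj G x y ≡ true

  Proper : Colouring G k → Set
  Proper c = ∀ x y y′ {a} → y ≢ y′ → c x y ≡ just a → c x y′ ≢ just a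

  record Valid (c : Colouring G k) : Set where
    field
      symmetric : Symmetric c
      supported : Supported c
      proper    : Proper c

  empty : Colouring G k
  empty _ _ = nothing

  valid-empty : Valid empty
  valid-empty = record
    { symmetric = λ _ _ → refl ; supported = λ _ _ ne → contradiction refl ne ; proper = λ _ _ _ _ () }

  paint-keeps : Symmetric c → c u w ≡ nothing → c x y ≡ just a → paint G c u w col x y ≡ just a
  paint-keeps {c} {u} {w} {x} {y} {col = col} sym-c free e with paint-cases c u w col x y
  ... | inj₂ (_ , e′)                 = trans e′ e
  ... | inj₁ (inj₁ (refl , refl) , _) = contradiction (trans (sym e) free) λ ()
  ... | inj₁ (inj₂ (refl , refl) , _) = contradiction (trans (sym e) (trans (sym-c x y) free)) λ ()

  valid-paint : Valid c → Legal G c u w col → Valid (paint G c u w col)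
  valid-paint {c} {u} {w} {col} v (adj , _ , free-u , free-w) = record
    { symmetric = symmetric′ ; supported = supported′ ; proper = proper′ }
    where
    open Valid v
    symmetric′ : Symmetric (paint G c u w col)
    symmetric′ x y with paint-cases c u w col x y | paint-cases c u w col y x
    ... | inj₁ (_ , e)  | inj₁ (_ , e′) = trans e (sym e′)
    ... | inj₁ (s , _)  | inj₂ (¬s , _) = contradiction (SameEdge-reverse s) ¬s
    ... | inj₂ (¬s , _) | inj₁ (s , _)  = contradiction (SameEdge-reverse s) ¬s
    ... | inj₂ (_ , e)  | inj₂ (_ , e′) = trans e (trans (symmetric x y) (sym e′))
    supported′ : Supported (paint G c u w col)
    supported′ x y ne with paint-coloured {c = c} {u = u} {w = w} {col = col} {x = x} {y = y} ne
    ... | inj₁ (inj₁ (refl , refl)) = adj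
    ... | inj₁ (inj₂ (refl , refl)) = trans (Graph.sym G w u) adj
    ... | inj₂ ne′                  = supported x y ne′
    proper′ : Proper (paint G c u w col)
    proper′ x y y′ y≢y′ e e′ with paint-just {c = c} e | paint-just {c = c} e′
    ... | inj₁ (inj₁ (refl , refl) , refl) | inj₁ (inj₁ (_ , refl) , _)    = y≢y′ refl
    ... | inj₁ (inj₁ (refl , refl) , refl) | inj₁ (inj₂ (refl , refl) , _) = y≢y′ refl
    ... | inj₁ (inj₂ (refl , refl) , refl) | inj₁ (inj₁ (refl , refl) , _) = y≢y′ refl
    ... | inj₁ (inj₂ (refl , refl) , refl) | inj₁ (inj₂ (_ , refl) , _)    = y≢y′ refl
    ... | inj₁ (inj₁ (refl , refl) , refl) | inj₂ e″ = free-u y′ e″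
    ... | inj₁ (inj₂ (refl , refl) , refl) | inj₂ e″ = free-w y′ e″
    ... | inj₂ e″ | inj₁ (inj₁ (refl , refl) , refl) = free-u y e″
    ... | inj₂ e″ | inj₁ (inj₂ (refl , refl) , refl) = free-w y e″
    ... | inj₂ e″ | inj₂ e‴                          = proper x y y′ y≢y′ e″ e‴

  legal-if-untouched : Adj G p q ≡ true → c p q ≡ nothing →
                       (∀ x y → c x y ≡ just col → ¬ ShareEnd (x , y) (p , q)) → Legal G c p q col
  legal-if-untouched adj free untouched =
    adj , free , (λ y e → untouched _ y e (inj₁ refl))
               , (λ y e → untouched _ y e (inj₂ (inj₁ refl)))

  symmetric-resp : Symmetric c → SameEdge x y u w → c x y ≡ c u w
  symmetric-resp _     (inj₁ (refl , refl)) = refl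
  symmetric-resp sym-c (inj₂ (refl , refl)) = sym-c _ _

  paint-keeps-coloured : Symmetric c → c u w ≡ nothing → c x y ≢ nothing →
                         paint G c u w col x y ≢ nothing
  paint-keeps-coloured sym-c free ne =
    ≡just⇒≢nothing (paint-keeps sym-c free (proj₂ (≢nothing⇒≡just ne)))

  legal-ends : Legal G c u w col → SameEdge u w x y →
               (∀ v → c x v ≢ just col) × (∀ v → c y v ≢ just col)
  legal-ends (_ , _ , free-u , free-w) (inj₁ (refl , refl)) = free-u , free-w
  legal-ends (_ , _ , free-u , free-w) (inj₂ (refl , refl)) = free-w , free-u

  legal-after-one : Adj G p q ≡ true → ¬ ShareEnd (u , w) (p , q) →
                    Legal G (paint G empty u w a) p q col
  legal-after-one {u = u} {w} adj disjoint = legal-if-untouched adj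
    (paint-other {c = empty} λ s → disjoint (ShareEnd-respˡ s (inj₁ refl)))
    (λ x y e → case paint-just {c = empty} {u = u} {w = w} e of λ
       { (inj₁ (s , _)) → disjoint ∘ ShareEnd-respˡ s ; (inj₂ ()) })

gap : Maybe A → ℕ
gap nothing  = 1
gap (just _) = 0

module Game (G : Graph) {k : ℕ} where

  open Edges G
  open Positions G {k}

  private variable
    c : Colouring G k
    u w : Vertex
    col : Fin k
    pl : Player

  AliceWins⇒complete : Valid c → AliceWins G k pl c → ∃ λ c′ → Valid c′ × AllColoured G c′
  AliceWins⇒complete v (finished done)          = _ , v , done
  AliceWins⇒complete v (aliceMove u w col L win) = AliceWins⇒complete (valid-paint v L) win
  AliceWins⇒complete v (bobMove (u , w , col , L) reply) =
    AliceWins⇒complete (valid-paint v L) (reply u w col L)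

  star⇒¬AliceWinsB : ∀ {x d} → Star x d → k < d → ¬ AliceWinsB G k
  star⇒¬AliceWinsB {x} star k<d win with AliceWins⇒complete valid-empty win
  ... | c , v , done = <⇒≱ k<d (injective⇒≤ colour-injective)
    where
    open Star star
    open Valid v
    coloured : ∀ i → ∃ λ a → c x (leaf i) ≡ just a
    coloured i = ≢nothing⇒≡just (done x (leaf i) (leaf-adjacent i))
    colour-injective : Injective _≡_ _≡_ (λ i → proj₁ (coloured i))
    colour-injective {i} {j} e with i ≟ j
    ... | yes i≡j = i≡j
    ... | no i≢j  = contradiction (trans (proj₂ (coloured j)) (cong just (sym e)))
                      (proper x (leaf i) (leaf j) (i≢j ∘ leaf-injective) (proj₂ (coloured i)))

  Blocked : Colouring G k → Vertex → Vertex → Fin k → Set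
  Blocked c u w col = (∃ λ z → c u z ≡ just col) ⊎ (∃ λ z → c w z ≡ just col)

  Blocked-resp : ∀ {x y} → SameEdge u w x y → Blocked c u w col → Blocked c x y col
  Blocked-resp (inj₁ (refl , refl)) bl       = bl
  Blocked-resp (inj₂ (refl , refl)) (inj₁ p) = inj₂ p
  Blocked-resp (inj₂ (refl , refl)) (inj₂ p) = inj₁ p

  private
    present? : ∀ (c : Colouring G k) x col → Dec (∃ λ z → c x z ≡ just col)
    present? c x col = any? λ z → ≡-dec-Maybe _≟_ (c x z) (just col)

  legal-or-blocked : Adj G u w ≡ true → c u w ≡ nothing →
                     (∃ λ col → Legal G c u w col) ⊎ (∀ col → Blocked c u w col)
  legal-or-blocked {u} {w} {c} adj free
    with any? (λ col → ¬? (present? c u col) ×-dec ¬? (present? c w col))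
  ... | yes (col , ¬at-u , ¬at-w) =
        inj₁ (col , adj , free , (λ z e → ¬at-u (z , e)) , (λ z e → ¬at-w (z , e)))
  ... | no none = inj₂ blocked
    where
    blocked : ∀ col → Blocked c u w col
    blocked col with present? c u col | present? c w col
    ... | yes at-u | _       = inj₁ at-u
    ... | no _     | yes at-w = inj₂ at-w
    ... | no ¬at-u | no ¬at-w = contradiction (col , ¬at-u , ¬at-w) none

  complete-or-gap : ∀ (c : Colouring G k) →
                    AllColoured G c ⊎ ∃₂ λ u w → Adj G u w ≡ true × c u w ≡ nothing
  complete-or-gap c
    with any? (λ u → any? λ w → (Adj G u w ≟ᵇ true) ×-dec ≡-dec-Maybe _≟_ (c u w) nothing)
  ... | yes (u , w , adj , free) = inj₂ (u , w , adj , free)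
  ... | no none                  = inj₁ λ u w adj free → none (u , w , adj , free)

  gaps : Colouring G k → List (Vertex × Vertex) → ℕ
  gaps c []             = 0
  gaps c ((x , y) ∷ ps) = gap (c x y) + gaps c ps

  private
    gap-paint-≤ : ∀ (c : Colouring G k) u w col x y → gap (paint G c u w col x y) ≤ gap (c x y)
    gap-paint-≤ c u w col x y with paint-cases c u w col x y
    ... | inj₁ (_ , e) rewrite e = z≤n
    ... | inj₂ (_ , e) rewrite e = ≤-refl

    gaps-paint-≤ : ∀ (c : Colouring G k) u w col ps → gaps (paint G c u w col) ps ≤ gaps c ps
    gaps-paint-≤ c u w col []             = z≤n
    gaps-paint-≤ c u w col ((x , y) ∷ ps) =
      +-mono-≤ (gap-paint-≤ c u w col x y) (gaps-paint-≤ c u w col ps)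

  gaps-paint-< : ∀ (c : Colouring G k) {u w} col {ps} → c u w ≡ nothing → (u , w) ∈ ps →
                 gaps (paint G c u w col) ps < gaps c ps
  gaps-paint-< c {u} {w} col {_ ∷ ps} free (here refl) rewrite paint-here c u w col | free =
    +-mono-<-≤ (s≤s z≤n) (gaps-paint-≤ c u w col ps)
  gaps-paint-< c {u} {w} col {(x , y) ∷ _} free (there i) =
    +-mono-≤-< (gap-paint-≤ c u w col x y) (gaps-paint-< c col free i)

  module _ (Inv : Colouring G k → Set)
           (inv-paint : ∀ {c u w col} → Inv c → Legal G c u w col → Inv (paint G c u w col))
           (extendable : ∀ {c u w} → Inv c → Adj G u w ≡ true → c u w ≡ nothing →
                         ∃ λ col → Legal G c u w col)
    where

    invariant⇒AliceWins : Inv c → ∀ pl → AliceWins G k pl c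
    invariant⇒AliceWins {c} = go c (<-wellFounded (gaps c pairs))
      where
      pairs : List (Vertex × Vertex)
      pairs = cartesianProduct (allFin (N G)) (allFin (N G))

      go : ∀ c → Acc _<_ (gaps c pairs) → Inv c → ∀ pl → AliceWins G k pl c
      go c (acc smaller) inv pl with complete-or-gap c
      ... | inj₁ done = finished done
      ... | inj₂ (u , w , adj , free) with extendable inv adj free
      ...   | col , L = move pl
        where
        continue : ∀ {u w col} → Legal G c u w col → ∀ pl → AliceWins G k pl (paint G c u w col)
        continue {u} {w} {col} L@(_ , free , _) =
          go _ (smaller (gaps-paint-< c col free (∈-cartesianProduct⁺ (∈-allFin u) (∈-allFin w))))
             (inv-paint inv L)

        move : ∀ pl → AliceWins G k pl c
        move alice = aliceMove u w col L (continue L bob)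
        move bob   = bobMove (u , w , col , L) (λ _ _ _ L′ → continue L′ alice)

data Triangle : Set where
  X Y : Triangle

other : Triangle → Triangle
other X = Y
other Y = X

other≢ : ∀ T → other T ≢ T
other≢ X ()
other≢ Y ()

other-injective : ∀ {T T′} → other T ≡ other T′ → T ≡ T′
other-injective {X} {X} _ = refl
other-injective {Y} {Y} _ = refl

triangle-cases : ∀ T′ T → T′ ≡ T ⊎ T′ ≡ other T
triangle-cases X X = inj₁ refl
triangle-cases X Y = inj₂ refl
triangle-cases Y X = inj₂ refl
triangle-cases Y Y = inj₁ refl

module Vase (G : Graph) where

  open Edges G
  open Positions G

  record DoubleVase (n : ℕ) : Set where
    field
      hub           : Vertex
      tip           : Triangle → Bool → Vertex
      spokes        : Star hub (4 + n)
      hub-neighbour : ∀ {z} → Adj G hub z ≡ true → ∃ λ i → Star.leaf spokes i ≡ z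
      hub-tip       : ∀ T b → Adj G hub (tip T b) ≡ true
      rim-adjacent  : ∀ T → Adj G (tip T false) (tip T true) ≡ true
      edge-kind     : ∀ {u w} → Adj G u w ≡ true →
                      (∃ λ z → SameEdge u w hub z)
                      ⊎ (∃ λ T → SameEdge u w (tip T false) (tip T true))
      hub≢tip       : ∀ T b → hub ≢ tip T b
      tip-injective : ∀ {T T′ b b′} → tip T b ≡ tip T′ b′ → T ≡ T′ × b ≡ b′

  module Shape {n} (D : DoubleVase n) where

    open DoubleVase D public

    private variable
      T : Triangle
      b : Bool
      y z : Vertex

    rim : Triangle → Vertex × Vertex
    rim T = tip T false , tip T true

    Rim : Triangle → Vertex → Vertex → Set
    Rim T x y = SameEdge x y (tip T false) (tip T true)

    tip-neighbour : Adj G (tip T b) z ≡ true → z ≡ hub ⊎ z ≡ tip T (not b)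
    tip-neighbour {T} {b} adj with edge-kind adj
    ... | inj₁ (_ , inj₁ (e , _)) = contradiction (sym e) (hub≢tip T b)
    ... | inj₁ (_ , inj₂ (_ , e)) = inj₁ e
    ... | inj₂ (T′ , inj₁ (e , e′)) with tip-injective e
    ...   | refl , refl = inj₂ e′
    tip-neighbour adj | inj₂ (T′ , inj₂ (e , e′)) with tip-injective e
    ...   | refl , refl = inj₂ e′

    NotOn : Vertex → Triangle → Set
    NotOn y T = ∀ b → y ≢ tip T b

    tip? : ∀ y → (∃₂ λ T b → y ≡ tip T b) ⊎ (∀ T → NotOn y T)
    tip? y with y ≟ tip X false | y ≟ tip X true | y ≟ tip Y false | y ≟ tip Y true
    ... | yes e | _     | _     | _     = inj₁ (X , false , e)
    ... | no _  | yes e | _     | _     = inj₁ (X , true , e)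
    ... | no _  | no _  | yes e | _     = inj₁ (Y , false , e)
    ... | no _  | no _  | no _  | yes e = inj₁ (Y , true , e)
    ... | no a  | no b  | no c  | no d  =
          inj₂ λ { X false → a ; X true → b ; Y false → c ; Y true → d }

    leaf-neighbour : y ≢ hub → (∀ T → NotOn y T) → Adj G y z ≡ true → z ≡ hub
    leaf-neighbour y≢hub not-tip adj with edge-kind adj
    ... | inj₁ (_ , inj₁ (e , _)) = contradiction e y≢hub
    ... | inj₁ (_ , inj₂ (_ , e)) = e
    ... | inj₂ (T , inj₁ (e , _)) = contradiction e (not-tip T false)
    ... | inj₂ (T , inj₂ (e , _)) = contradiction e (not-tip T true)

    tip-elsewhere : ∀ {T′} → T′ ≢ T → NotOn (tip T′ b) T
    tip-elsewhere T′≢T _ e = T′≢T (proj₁ (tip-injective e))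

    avoiding : ∀ y → ∃ λ T → NotOn y T
    avoiding y with tip? y
    ... | inj₁ (T , _ , refl) = other T , tip-elsewhere (≢-sym (other≢ T))
    ... | inj₂ not-tip        = X , not-tip X

    spoke-rim-disjoint : NotOn y T → ¬ ShareEnd (hub , y) (rim T)
    spoke-rim-disjoint {T = T} _   (inj₁ e)               = hub≢tip T false e
    spoke-rim-disjoint {T = T} _   (inj₂ (inj₁ e))        = hub≢tip T true e
    spoke-rim-disjoint         y∉T (inj₂ (inj₂ (inj₁ e))) = y∉T false e
    spoke-rim-disjoint         y∉T (inj₂ (inj₂ (inj₂ e))) = y∉T true e

    hub∉rim : ¬ Rim T hub y
    hub∉rim {T} (inj₁ (e , _)) = hub≢tip T false e
    hub∉rim {T} (inj₂ (e , _)) = hub≢tip T true e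

    rims-disjoint : ∀ T → ¬ ShareEnd (rim T) (rim (other T))
    rims-disjoint T (inj₁ e)               = other≢ T (sym (proj₁ (tip-injective e)))
    rims-disjoint T (inj₂ (inj₁ e))        = other≢ T (sym (proj₁ (tip-injective e)))
    rims-disjoint T (inj₂ (inj₂ (inj₁ e))) = other≢ T (sym (proj₁ (tip-injective e)))
    rims-disjoint T (inj₂ (inj₂ (inj₂ e))) = other≢ T (sym (proj₁ (tip-injective e)))

    EdgeKind : Vertex → Vertex → Set
    EdgeKind u w = (∃ λ z → Adj G hub z ≡ true × SameEdge u w hub z) ⊎ (∃ λ T → Rim T u w)

    classify : ∀ {u w} → Adj G u w ≡ true → EdgeKind u w
    classify adj with edge-kind adj
    ... | inj₁ (z , s) = inj₁ (z , adjacent-resp (SameEdge-sym s) adj , s)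
    ... | inj₂ r       = inj₂ r

    spoke-index : Adj G hub z ≡ true → Fin (4 + n)
    spoke-index adj = proj₁ (hub-neighbour adj)

    spoke-index-injective : ∀ {z′} (adj : Adj G hub z ≡ true) (adj′ : Adj G hub z′ ≡ true) →
                            spoke-index adj ≡ spoke-index adj′ → z ≡ z′
    spoke-index-injective adj adj′ e =
      trans (sym (proj₂ (hub-neighbour adj)))
            (trans (cong (Star.leaf spokes) e) (proj₂ (hub-neighbour adj′)))

    slot : ∀ {u w} → EdgeKind u w → Fin (4 + n)
    slot (inj₁ (_ , adj , _)) = spoke-index adj
    slot (inj₂ (T , _))       = spoke-index (hub-tip (other T) false)

    slot-separates : ∀ {e e′} → IsEdge G e → IsEdge G e′ → e ≢ e′ → ShareEnd e e′ →
                     (κ : EdgeKind (proj₁ e) (proj₂ e)) →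
                     (κ′ : EdgeKind (proj₁ e′) (proj₂ e′)) →
                     slot κ ≢ slot κ′
    slot-separates (lt , _) (lt′ , _) e≢e′ _ (inj₁ (_ , adj , s)) (inj₁ (_ , adj′ , s′)) eq
      with spoke-index-injective adj adj′ eq
    ... | refl = e≢e′ (oriented-unique s s′ lt lt′)
    slot-separates _ _ _ sh (inj₁ (_ , adj , s)) (inj₂ (T , r)) eq
      with spoke-index-injective adj (hub-tip (other T) false) eq
    ... | refl = spoke-rim-disjoint (tip-elsewhere (other≢ T)) (ShareEnd-resp s r sh)
    slot-separates _ _ _ sh (inj₂ (T , r)) (inj₁ (_ , adj , s)) eq
      with spoke-index-injective adj (hub-tip (other T) false) (sym eq)
    ... | refl = spoke-rim-disjoint (tip-elsewhere (other≢ T)) (ShareEnd-resp s r (ShareEnd-sym sh))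
    slot-separates (lt , _) (lt′ , _) e≢e′ _ (inj₂ (T , r)) (inj₂ (T′ , r′)) eq
      with other-injective (proj₁ (tip-injective
             (spoke-index-injective (hub-tip (other T) false) (hub-tip (other T′) false) eq)))
    ... | refl = e≢e′ (oriented-unique r r′ lt lt′)

    slotting : ProperEdgeColouring (4 + n)
    slotting = record
      { colour = λ ie → slot (classify (proj₂ ie))
      ; proper = λ ie ie′ ne sh →
                   slot-separates ie ie′ ne sh (classify (proj₂ ie)) (classify (proj₂ ie′))
      }

    lineCliqueNumber : IsLineCliqueNumber G (4 + n)
    lineCliqueNumber = star⇒lineClique spokes , λ _ → lineClique-length≤ slotting

  module Strategy {n} (D : DoubleVase n) where

    open Shape D
    open Game G {4 + n}

    Position : Set
    Position = Colouring G (4 + n)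

    private variable
      c : Position
      τ : Triangle
      u w x y : Vertex
      col : Fin (4 + n)

    data Secure (T : Triangle) (c : Position) : Set where
      rim-seen-at-hub : ∀ {z a} → c hub z ≡ just a → c (tip T false) (tip T true) ≡ just a →
                        Secure T c
      spokes-coloured : (∀ b → c hub (tip T b) ≢ nothing) → Secure T c

    Safe : Position → Set
    Safe c = Valid c × ∀ T → Secure T c

    secure-paint : Symmetric c → c u w ≡ nothing → Secure τ c → Secure τ (paint G c u w col)
    secure-paint sym-c free (rim-seen-at-hub at-hub at-rim) =
      rim-seen-at-hub (paint-keeps sym-c free at-hub) (paint-keeps sym-c free at-rim)
    secure-paint sym-c free (spokes-coloured coloured) =
      spokes-coloured λ b → paint-keeps-coloured sym-c free (coloured b)

    safe-paint : Safe c → Legal G c u w col → Safe (paint G c u w col)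
    safe-paint (v , secure) L@(_ , free , _) =
      valid-paint v L , λ T → secure-paint (Valid.symmetric v) free (secure T)

    rim-value : Symmetric c → ∀ b → c (tip τ b) (tip τ (not b)) ≡ c (tip τ false) (tip τ true)
    rim-value sym-c false = refl
    rim-value sym-c true  = sym-c _ _

    rim-unblocked : Valid c → c (tip τ false) (tip τ true) ≡ nothing →
                    ¬ (∀ col → Blocked c (tip τ false) (tip τ true) col)
    rim-unblocked {c} {T} v free blocked = <⇒≱ (s≤s (s≤s (s≤s z≤n))) (two-values⇒≤2 via-spoke)
      where
      open Valid v
      via-tip : ∀ b {z col} → c (tip T b) z ≡ just col → c (tip T b) hub ≡ just col
      via-tip b {z} e with tip-neighbour (supported _ z (≡just⇒≢nothing e))
      ... | inj₁ refl = e
      ... | inj₂ refl = contradiction (trans (sym e) (trans (rim-value symmetric b) free)) λ ()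
      via-spoke : ∀ col → c (tip T false) hub ≡ just col ⊎ c (tip T true) hub ≡ just col
      via-spoke col with blocked col
      ... | inj₁ (_ , e) = inj₁ (via-tip false e)
      ... | inj₂ (_ , e) = inj₂ (via-tip true e)

    seen-at-hub : Safe c → Adj G hub y ≡ true → c hub y ≡ nothing → c y x ≡ just col →
                  ∃ λ z′ → c hub z′ ≡ just col
    seen-at-hub {c} {y} {z} (v , secure) adj free e with tip? y
    ... | inj₂ not-tip =
          contradiction (trans (sym e) (trans (cong (c y) z≡hub) (trans (symmetric y hub) free))) λ ()
      where
      open Valid v
      z≡hub : z ≡ hub
      z≡hub = leaf-neighbour (≢-sym (adjacent-distinct adj)) not-tip
                             (supported y z (≡just⇒≢nothing e))
    ... | inj₁ (T , b , refl) with tip-neighbour (Valid.supported v _ z (≡just⇒≢nothing e)) | secure T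
    ...   | inj₁ refl | _ = contradiction (trans (sym e) (trans (Valid.symmetric v _ _) free)) λ ()
    ...   | inj₂ refl | rim-seen-at-hub {z′} at-hub at-rim =
            z′ , trans at-hub (cong just (just-injective (trans (sym at-rim)
                   (trans (sym (rim-value (Valid.symmetric v) b)) e))))
    ...   | inj₂ refl | spokes-coloured coloured = contradiction free (coloured b)

    hub-unsaturated : Supported c → Adj G hub y ≡ true → c hub y ≡ nothing →
                      ¬ (∀ col → ∃ λ z → c hub z ≡ just col)
    hub-unsaturated {c} {y} supported adj free saturated =
      <⇒≱ (n<1+n (3 + n)) (injective⇒≤ compress-injective)
      where
      adj-at : ∀ col → Adj G hub (proj₁ (saturated col)) ≡ true
      adj-at col = supported hub _ (≡just⇒≢nothing (proj₂ (saturated col)))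
      avoids-y : ∀ col → spoke-index adj ≢ spoke-index (adj-at col)
      avoids-y col eq with spoke-index-injective adj (adj-at col) eq
      ... | refl = contradiction (trans (sym free) (proj₂ (saturated col))) λ ()
      compress : Fin (4 + n) → Fin (3 + n)
      compress col = punchOut (avoids-y col)
      compress-injective : Injective _≡_ _≡_ compress
      compress-injective {i} {j} eq =
        just-injective (trans (sym (proj₂ (saturated i)))
          (trans (cong (c hub) (spoke-index-injective (adj-at i) (adj-at j)
                   (punchOut-injective (avoids-y i) (avoids-y j) eq)))
                 (proj₂ (saturated j))))

    safe-extendable : Safe c → Adj G u w ≡ true → c u w ≡ nothing → ∃ λ col → Legal G c u w col
    safe-extendable {c} s@(v , _) adj free with legal-or-blocked adj free
    ... | inj₁ legal = legal
    ... | inj₂ blocked with classify adj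
    ...   | inj₂ (T , r) =
            ⊥-elim (rim-unblocked v (trans (symmetric-resp (Valid.symmetric v) (SameEdge-sym r)) free)
                                    (λ col → Blocked-resp r (blocked col)))
    ...   | inj₁ (y , adj-y , sp) = ⊥-elim (hub-unsaturated (Valid.supported v) adj-y free′ saturated)
      where
      free′ : c hub y ≡ nothing
      free′ = trans (symmetric-resp (Valid.symmetric v) (SameEdge-sym sp)) free
      saturated : ∀ col → ∃ λ z → c hub z ≡ just col
      saturated col with Blocked-resp sp (blocked col)
      ... | inj₁ at-hub   = at-hub
      ... | inj₂ (z , at-y) = seen-at-hub s adj-y free′ at-y

    safe⇒AliceWins : Safe c → ∀ pl → AliceWins G (4 + n) pl c
    safe⇒AliceWins = invariant⇒AliceWins Safe safe-paint safe-extendable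

    secure-both : Secure τ c → Secure (other τ) c → ∀ T′ → Secure T′ c
    secure-both {X} s s′ X = s
    secure-both {X} s s′ Y = s′
    secure-both {Y} s s′ X = s′
    secure-both {Y} s s′ Y = s

    record Opened (c : Position) : Set where
      field
        valid   : Valid c
        T       : Triangle
        z       : Vertex
        a       : Fin (4 + n)
        z∉T     : NotOn z T
        hub-z   : c hub z ≡ just a
        rim-T   : c (tip T false) (tip T true) ≡ just a
        support : ∀ {x y} → c x y ≢ nothing → Rim T x y ⊎ SameEdge x y hub z

    module Opening {c} (o : Opened c) where

      open Opened o public
      open Valid valid

      T′ : Triangle
      T′ = other T

      coloured-edge : ∀ {x y col} → c x y ≡ just col → (Rim T x y ⊎ SameEdge x y hub z) × col ≡ a
      coloured-edge e with support (≡just⇒≢nothing e)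
      ... | inj₁ r = inj₁ r , just-injective (trans (sym e) (trans (symmetric-resp symmetric r) rim-T))
      ... | inj₂ s = inj₂ s , just-injective (trans (sym e) (trans (symmetric-resp symmetric s) hub-z))

      rim-T′-uncoloured : c (tip T′ false) (tip T′ true) ≡ nothing
      rim-T′-uncoloured = ¬≢nothing λ ne → case support ne of λ
        { (inj₁ r) → rims-disjoint T (ShareEnd-sym (SameEdge⇒ShareEnd r))
        ; (inj₂ s) → hub∉rim (SameEdge-sym s) }

      another : Fin (4 + n)
      another with a
      ... | zero  = suc zero
      ... | suc _ = zero

      another≢a : another ≢ a
      another≢a with a
      ... | zero  = λ ()
      ... | suc _ = λ ()

      bob-can-move : Σ Vertex λ u → Σ Vertex λ w → Σ (Fin (4 + n)) λ col → Legal G c u w col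
      bob-can-move =
        tip T′ false , tip T′ true , another ,
        legal-if-untouched (rim-adjacent T′) rim-T′-uncoloured
          (λ x y e _ → another≢a (proj₂ (coloured-edge {x} {y} e)))

    module Reply {c} (o : Opened c) {u w b} (L : Legal G c u w b) where

      open Opening o
      open Valid valid

      c′ : Position
      c′ = paint G c u w b

      v′ : Valid c′
      v′ = valid-paint valid L

      free : c u w ≡ nothing
      free = proj₁ (proj₂ L)

      secure-T : Secure T c′
      secure-T = secure-paint symmetric free (rim-seen-at-hub hub-z rim-T)

      safe : Secure T′ c′ → AliceWins G (4 + n) alice c′
      safe sec = safe⇒AliceWins (v′ , secure-both secure-T sec) alice

      reply : ∀ {p q col} → Legal G c′ p q col → Secure T′ (paint G c′ p q col) →
              AliceWins G (4 + n) alice c′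
      reply L′@(_ , free′ , _) sec =
        aliceMove _ _ _ L′ (safe⇒AliceWins
          (valid-paint v′ L′ , secure-both (secure-paint (Valid.symmetric v′) free′ secure-T) sec) bob)

      colour-after : ∀ {x y col} → c′ x y ≡ just col →
                     (SameEdge x y u w × col ≡ b) ⊎ ((Rim T x y ⊎ SameEdge x y hub z) × col ≡ a)
      colour-after e with paint-just {c = c} e
      ... | inj₁ bob′ = inj₁ bob′
      ... | inj₂ e′   = inj₂ (coloured-edge e′)

      rim-like-spoke : ∀ {y col} → c′ hub y ≡ just col → ¬ Rim T′ u w →
                       (∀ x x′ → c′ x x′ ≡ just col → ¬ ShareEnd (x , x′) (rim T′)) →
                       AliceWins G (4 + n) alice c′
      rim-like-spoke {y} {col} at-hub ¬bob untouched =
        reply (legal-if-untouched (rim-adjacent T′) free′ untouched)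
              (rim-seen-at-hub (paint-keeps (Valid.symmetric v′) free′ at-hub)
                               (paint-here c′ (tip T′ false) (tip T′ true) col))
        where
        free′ : c′ (tip T′ false) (tip T′ true) ≡ nothing
        free′ = trans (paint-other {c = c} (¬bob ∘ SameEdge-sym)) rim-T′-uncoloured

      after-rim : Rim T′ u w → AliceWins G (4 + n) alice c′
      after-rim r with b ≟ a
      ... | yes refl =
            safe (rim-seen-at-hub (paint-keeps symmetric free hub-z) (paint-same {c = c} (SameEdge-sym r)))
      ... | no b≢a   =
            reply (legal-if-untouched (hub-tip T false) free′ untouched)
                  (rim-seen-at-hub (paint-here c′ hub (tip T false) b)
                                   (paint-keeps (Valid.symmetric v′) free′
                                                (paint-same {c = c} (SameEdge-sym r))))
        where
        tip-T∉T′ : NotOn (tip T false) T′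
        tip-T∉T′ = tip-elsewhere (≢-sym (other≢ T))
        free′ : c′ hub (tip T false) ≡ nothing
        free′ = trans (paint-other {c = c} λ s →
                        spoke-rim-disjoint tip-T∉T′ (SameEdge⇒ShareEnd (SameEdge-trans s r)))
                      (¬≢nothing λ ne → case support ne of λ
                        { (inj₁ r′)             → hub∉rim r′
                        ; (inj₂ (inj₁ (_ , e))) → z∉T false (sym e)
                        ; (inj₂ (inj₂ (_ , e))) → hub≢tip T false (sym e) })
        untouched : ∀ x x′ → c′ x x′ ≡ just b → ¬ ShareEnd (x , x′) (hub , tip T false)
        untouched x x′ e sh with colour-after e
        ... | inj₁ (s , _)   = spoke-rim-disjoint tip-T∉T′
                                 (ShareEnd-sym (ShareEnd-resp (SameEdge-trans s r) (inj₁ (refl , refl)) sh))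
        ... | inj₂ (_ , b≡a) = b≢a b≡a

      module _ {y} (s : SameEdge u w hub y) where

        bob-at-hub : c′ hub y ≡ just b
        bob-at-hub = paint-same {c = c} (SameEdge-sym s)

        hub-y-free : c hub y ≡ nothing
        hub-y-free = trans (symmetric-resp symmetric (SameEdge-sym s)) free

        b≢a : b ≢ a
        b≢a refl = proj₁ (legal-ends L s) z hub-z

        bob-off-rim : ¬ Rim T′ u w
        bob-off-rim r = hub∉rim (SameEdge-trans (SameEdge-sym s) r)

        after-far-spoke : NotOn y T′ → AliceWins G (4 + n) alice c′
        after-far-spoke y∉T′ = rim-like-spoke bob-at-hub bob-off-rim untouched
          where
          untouched : ∀ x x′ → c′ x x′ ≡ just b → ¬ ShareEnd (x , x′) (rim T′)
          untouched x x′ e sh with colour-after e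
          ... | inj₁ (s′ , _)  =
                spoke-rim-disjoint y∉T′ (ShareEnd-resp (SameEdge-trans s′ s) (inj₁ (refl , refl)) sh)
          ... | inj₂ (_ , b≡a) = b≢a b≡a

        after-near-spoke : ∀ β → y ≡ tip T′ β → AliceWins G (4 + n) alice c′
        after-near-spoke β refl with z ≟ tip T′ (not β)
        ... | yes refl = safe (spokes-coloured both)
          where
          both : ∀ β′ → c′ hub (tip T′ β′) ≢ nothing
          both β′ with β′ ≟ᵇ β
          ... | yes refl = ≡just⇒≢nothing bob-at-hub
          ... | no β′≢β  =
                subst (λ β″ → c′ hub (tip T′ β″) ≢ nothing) (sym (¬-not β′≢β))
                      (≡just⇒≢nothing (paint-keeps symmetric free hub-z))
        ... | no z≢tip = rim-like-spoke (paint-keeps symmetric free hub-z) bob-off-rim untouched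
          where
          z∉T′ : NotOn z T′
          z∉T′ β′ with β′ ≟ᵇ β
          ... | yes refl = λ { refl → contradiction (trans (sym hub-z) hub-y-free) λ () }
          ... | no β′≢β  = λ e → z≢tip (trans e (cong (tip T′) (¬-not β′≢β)))
          untouched : ∀ x x′ → c′ x x′ ≡ just a → ¬ ShareEnd (x , x′) (rim T′)
          untouched x x′ e sh with colour-after e
          ... | inj₁ (_ , a≡b)     = b≢a (sym a≡b)
          ... | inj₂ (inj₁ r , _)  = rims-disjoint T (ShareEnd-respˡ r sh)
          ... | inj₂ (inj₂ s′ , _) = spoke-rim-disjoint z∉T′ (ShareEnd-respˡ s′ sh)

      secure-second : AliceWins G (4 + n) alice c′
      secure-second with classify (proj₁ L)
      ... | inj₂ (T″ , r) with triangle-cases T″ T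
      ...   | inj₁ refl =
              contradiction (trans (sym free) (trans (symmetric-resp symmetric r) rim-T)) λ ()
      ...   | inj₂ refl = after-rim r
      secure-second | inj₁ (y , _ , s) with y ≟ tip T′ false | y ≟ tip T′ true
      ...   | yes e | _     = after-near-spoke s false e
      ...   | no _  | yes e = after-near-spoke s true e
      ...   | no e  | no e′ = after-far-spoke s λ { false → e ; true → e′ }

    RimAndSpoke : Triangle → Vertex → Vertex → Vertex → Vertex → Vertex → Set
    RimAndSpoke T z u w p q = (Rim T u w × SameEdge p q hub z) ⊎ (SameEdge u w hub z × Rim T p q)

    opened : ∀ {T z u w p q a} → NotOn z T → RimAndSpoke T z u w p q →
             (L : Legal G empty u w a) → Legal G (paint G empty u w a) p q a →
             Opened (paint G (paint G empty u w a) p q a)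
    opened {T} {z} {u} {w} {p} {q} {a} z∉T shape L L′@(_ , free′ , _) = record
      { valid = valid-paint v₁ L′ ; T = T ; z = z ; a = a ; z∉T = z∉T
      ; hub-z = painted spoke-painted ; rim-T = painted rim-painted
      ; support = sort ∘ painted-only
      }
      where
      c₁ : Position
      c₁ = paint G empty u w a
      v₁ : Valid c₁
      v₁ = valid-paint valid-empty L
      Painted : Vertex → Vertex → Set
      Painted x y = SameEdge x y u w ⊎ SameEdge x y p q
      painted : ∀ {x y} → Painted x y → paint G c₁ p q a x y ≡ just a
      painted {x} {y} (inj₁ s) =
        paint-keeps {c = c₁} {u = p} {w = q} {x = x} {y = y} {col = a} (Valid.symmetric v₁) free′
          (paint-same {c = empty} s)
      painted (inj₂ s) = paint-same {c = c₁} s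
      painted-only : ∀ {x y} → paint G c₁ p q a x y ≢ nothing → Painted x y
      painted-only ne with paint-coloured {c = c₁} ne
      ... | inj₁ s  = inj₂ s
      ... | inj₂ ne′ with paint-coloured {c = empty} ne′
      ...   | inj₁ s   = inj₁ s
      ...   | inj₂ ne″ = contradiction refl ne″
      spoke-painted : Painted hub z
      spoke-painted = case shape of λ
        { (inj₁ (_ , s)) → inj₂ (SameEdge-sym s) ; (inj₂ (s , _)) → inj₁ (SameEdge-sym s) }
      rim-painted : Painted (tip T false) (tip T true)
      rim-painted = case shape of λ
        { (inj₁ (r , _)) → inj₁ (SameEdge-sym r) ; (inj₂ (_ , r)) → inj₂ (SameEdge-sym r) }
      sort : ∀ {x y} → Painted x y → Rim T x y ⊎ SameEdge x y hub z
      sort {x} {y} = case shape of λ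
        { (inj₁ (r , s)) → λ { (inj₁ s′) → inj₁ (SameEdge-trans s′ r)
                              ; (inj₂ s′) → inj₂ (SameEdge-trans s′ s) }
        ; (inj₂ (s , r)) → λ { (inj₁ s′) → inj₂ (SameEdge-trans s′ s)
                              ; (inj₂ s′) → inj₁ (SameEdge-trans s′ r) } }

    secure-first : ∀ {T z u w p q a} → NotOn z T → Adj G hub z ≡ true → RimAndSpoke T z u w p q →
                   Legal G empty u w a → AliceWins G (4 + n) alice (paint G empty u w a)
    secure-first {T} {z} {u} {w} {p} {q} {a} z∉T adj-z shape L =
      aliceMove p q a L′ (bobMove (Opening.bob-can-move o) λ _ _ _ → Reply.secure-second o)
      where
      apart : ¬ ShareEnd (u , w) (p , q)
      apart = case shape of λ
        { (inj₁ (r , s)) sh → spoke-rim-disjoint z∉T (ShareEnd-resp s r (ShareEnd-sym sh))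
        ; (inj₂ (s , r)) sh → spoke-rim-disjoint z∉T (ShareEnd-resp s r sh) }
      adjacent : Adj G p q ≡ true
      adjacent = case shape of λ
        { (inj₁ (_ , s)) → adjacent-resp s adj-z
        ; (inj₂ (_ , r)) → adjacent-resp r (rim-adjacent T) }
      L′ : Legal G (paint G empty u w a) p q a
      L′ = legal-after-one adjacent apart
      o : Opened (paint G (paint G empty u w a) p q a)
      o = opened z∉T shape L L′

    aliceWinsB : AliceWinsB G (4 + n)
    aliceWinsB = bobMove (hub , tip X false , zero , legal-if-untouched (hub-tip X false) refl λ _ _ ())
                         λ _ _ _ → first-reply
      where
      first-reply : ∀ {u w a} → Legal G empty u w a → AliceWins G (4 + n) alice (paint G empty u w a)
      first-reply L with classify (proj₁ L)
      ... | inj₁ (y , adj-y , s) =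
            secure-first {T = proj₁ (avoiding y)} (proj₂ (avoiding y)) adj-y
                         (inj₂ (s , inj₁ (refl , refl))) L
      ... | inj₂ (T , r) =
            secure-first {z = tip (other T) false} (tip-elsewhere (other≢ T)) (hub-tip (other T) false)
                   (inj₁ (r , inj₁ (refl , refl))) L

tip-label : Triangle → Bool → ℕ
tip-label X false = 1
tip-label X true  = 2
tip-label Y false = 3
tip-label Y true  = 4

tip-label-injective : ∀ {T T′ b b′} → tip-label T b ≡ tip-label T′ b′ → T ≡ T′ × b ≡ b′
tip-label-injective {X} {X} {false} {false} _ = refl , refl
tip-label-injective {X} {X} {true}  {true}  _ = refl , refl
tip-label-injective {Y} {Y} {false} {false} _ = refl , refl
tip-label-injective {Y} {Y} {true}  {true}  _ = refl , refl
tip-label-injective {X} {X} {false} {true}  ()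
tip-label-injective {X} {X} {true}  {false} ()
tip-label-injective {X} {Y} {false} {false} ()
tip-label-injective {X} {Y} {false} {true}  ()
tip-label-injective {X} {Y} {true}  {false} ()
tip-label-injective {X} {Y} {true}  {true}  ()
tip-label-injective {Y} {X} {false} {false} ()
tip-label-injective {Y} {X} {false} {true}  ()
tip-label-injective {Y} {X} {true}  {false} ()
tip-label-injective {Y} {X} {true}  {true}  ()
tip-label-injective {Y} {Y} {false} {true}  ()
tip-label-injective {Y} {Y} {true}  {false} ()

HubOrRimLabels : ℕ → ℕ → Set
HubOrRimLabels a b = a ≡ 0 ⊎ ∃ λ T → a ≡ tip-label T false × b ≡ tip-label T true

module _ {n : ℕ} where

  dvE-kind : ∀ a b → True (dvE n a b) → HubOrRimLabels a b
  dvE-kind 0 _ _ = inj₁ refl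
  dvE-kind 1 2 _ = inj₂ (X , refl , refl)
  dvE-kind 3 4 _ = inj₂ (Y , refl , refl)
  dvE-kind 1 0 ()
  dvE-kind 1 1 ()
  dvE-kind 1 (suc (suc (suc _))) ()
  dvE-kind 2 _ ()
  dvE-kind 3 0 ()
  dvE-kind 3 1 ()
  dvE-kind 3 2 ()
  dvE-kind 3 3 ()
  dvE-kind 3 (suc (suc (suc (suc (suc _))))) ()
  dvE-kind 4 _ ()
  dvE-kind (suc (suc (suc (suc (suc _))))) _ ()

  hub-label-neighbour : ∀ b → dvAdj n 0 b ≡ true → ∃ λ i → i < 4 + n × b ≡ suc i
  hub-label-neighbour 1 _ = 0 , s≤s z≤n , refl
  hub-label-neighbour 2 _ = 1 , s≤s (s≤s z≤n) , refl
  hub-label-neighbour 3 _ = 2 , s≤s (s≤s (s≤s z≤n)) , refl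
  hub-label-neighbour 4 _ = 3 , s≤s (s≤s (s≤s (s≤s z≤n))) , refl
  hub-label-neighbour (suc (suc (suc (suc (suc j))))) adj =
    4 + j , s≤s (s≤s (s≤s (s≤s j<n))) , refl
    where
    j<n : j < n
    j<n = <ᵇ⇒< j n (Equivalence.from T-≡ (trans (sym (∨-identityʳ (j <ᵇ n))) adj))

  hub-label-adjacent : ∀ i → i < 4 + n → dvAdj n 0 (suc i) ≡ true
  hub-label-adjacent 0 _ = refl
  hub-label-adjacent 1 _ = refl
  hub-label-adjacent 2 _ = refl
  hub-label-adjacent 3 _ = refl
  hub-label-adjacent (suc (suc (suc (suc j)))) (s≤s (s≤s (s≤s (s≤s j<n))))
    rewrite Equivalence.to T-≡ (<⇒<ᵇ j<n) = refl

  hub-tip-label : ∀ T b → dvAdj n 0 (tip-label T b) ≡ true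
  hub-tip-label X false = refl
  hub-tip-label X true  = refl
  hub-tip-label Y false = refl
  hub-tip-label Y true  = refl

  rim-label : ∀ T → dvAdj n (tip-label T false) (tip-label T true) ≡ true
  rim-label X = refl
  rim-label Y = refl

  tip-label≤ : ∀ T b → tip-label T b ≤ 4 + n
  tip-label≤ X false = s≤s z≤n
  tip-label≤ X true  = s≤s (s≤s z≤n)
  tip-label≤ Y false = s≤s (s≤s (s≤s z≤n))
  tip-label≤ Y true  = s≤s (s≤s (s≤s (s≤s z≤n)))

tip-label≢0 : ∀ T b → tip-label T b ≢ 0
tip-label≢0 X false ()
tip-label≢0 X true  ()
tip-label≢0 Y false ()
tip-label≢0 Y true  ()

module Labelled {G : Graph} {n m : ℕ} (iso : G ≅ DoubleVasePlusIsolated n m) where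

  open Edges G
  open Vase G
  open Inverse (proj₁ iso)

  label : Vertex → ℕ
  label v = toℕ (to v)

  adjacent⇔label : ∀ u w → Adj G u w ≡ dvAdj n (label u) (label w)
  adjacent⇔label = proj₂ iso

  label-injective : ∀ {u w} → label u ≡ label w → u ≡ w
  label-injective {u} {w} e =
    trans (sym (strictlyInverseʳ u)) (trans (cong from (toℕ-injective e)) (strictlyInverseʳ w))

  in-range : ∀ {i} → i ≤ 4 + n → i < 5 + n + m
  in-range i≤ = s≤s (≤-trans i≤ (m≤m+n (4 + n) m))

  vertex : ∀ i → i ≤ 4 + n → Vertex
  vertex i i≤ = from (fromℕ< (in-range i≤))

  label-vertex : ∀ i i≤ → label (vertex i i≤) ≡ i
  label-vertex i i≤ =
    trans (cong toℕ (strictlyInverseˡ (fromℕ< (in-range i≤)))) (toℕ-fromℕ< (in-range i≤))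

  is-vertex : ∀ {u} i i≤ → label u ≡ i → u ≡ vertex i i≤
  is-vertex i i≤ e = label-injective (trans e (sym (label-vertex i i≤)))

  adjacent-vertices : ∀ i i≤ j j≤ → dvAdj n i j ≡ true →
                      Adj G (vertex i i≤) (vertex j j≤) ≡ true
  adjacent-vertices i i≤ j j≤ adj =
    trans (adjacent⇔label _ _)
          (subst₂ (λ a b → dvAdj n a b ≡ true) (sym (label-vertex i i≤)) (sym (label-vertex j j≤))
                  adj)

  hub′ : Vertex
  hub′ = vertex 0 z≤n

  tip′ : Triangle → Bool → Vertex
  tip′ T b = vertex (tip-label T b) (tip-label≤ T b)

  spoke : Fin (4 + n) → Vertex
  spoke i = vertex (suc (toℕ i)) (toℕ<n i)

  SpokeOrRim : Vertex → Vertex → Set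
  SpokeOrRim u w =
    (∃ λ z → SameEdge u w hub′ z) ⊎ (∃ λ T → SameEdge u w (tip′ T false) (tip′ T true))

  label-tip : ∀ T b → label (tip′ T b) ≡ tip-label T b
  label-tip T b = label-vertex (tip-label T b) (tip-label≤ T b)

  oriented-kind : ∀ {u w} → HubOrRimLabels (label u) (label w) → SpokeOrRim u w
  oriented-kind {w = w} (inj₁ e)    = inj₁ (w , inj₁ (is-vertex 0 z≤n e , refl))
  oriented-kind (inj₂ (T , e , e′)) =
    inj₂ (T , inj₁ (is-vertex _ (tip-label≤ T false) e , is-vertex _ (tip-label≤ T true) e′))

  doubleVase : DoubleVase n
  doubleVase = record
    { hub           = hub′
    ; tip           = tip′
    ; spokes        = record
      { leaf           = spoke
      ; leaf-injective = λ {i} {j} e → toℕ-injective (suc-injective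
          (trans (sym (label-vertex _ (toℕ<n i))) (trans (cong label e) (label-vertex _ (toℕ<n j)))))
      ; leaf-adjacent  = λ i →
          adjacent-vertices 0 z≤n _ (toℕ<n i) (hub-label-adjacent (toℕ i) (toℕ<n i))
      }
    ; hub-neighbour = hub-neighbour′
    ; hub-tip       = λ T b → adjacent-vertices 0 z≤n _ (tip-label≤ T b) (hub-tip-label T b)
    ; rim-adjacent  = λ T → adjacent-vertices _ (tip-label≤ T false) _ (tip-label≤ T true) (rim-label T)
    ; edge-kind     = edge-kind′
    ; hub≢tip       = λ T b e →
        tip-label≢0 T b (trans (sym (label-tip T b)) (trans (cong label (sym e)) (label-vertex 0 z≤n)))
    ; tip-injective = λ {T} {T′} {b} {b′} e →
        tip-label-injective (trans (sym (label-tip T b)) (trans (cong label e) (label-tip T′ b′)))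
    }
    where
    hub-neighbour′ : ∀ {z} → Adj G hub′ z ≡ true → ∃ λ i → spoke i ≡ z
    hub-neighbour′ {z} adj with hub-label-neighbour (label z)
                                  (trans (cong (λ a → dvAdj n a (label z)) (sym (label-vertex 0 z≤n)))
                                         (trans (sym (adjacent⇔label hub′ z)) adj))
    ... | i , i< , e =
          fromℕ< i< , sym (is-vertex _ (toℕ<n (fromℕ< i<)) (trans e (cong suc (sym (toℕ-fromℕ< i<)))))
    edge-kind′ : ∀ {u w} → Adj G u w ≡ true → SpokeOrRim u w
    edge-kind′ {u} {w} adj
      with Equivalence.to T-∨ (Equivalence.from T-≡ (trans (sym (adjacent⇔label u w)) adj))
    ... | inj₁ e = oriented-kind (dvE-kind _ _ e)
    ... | inj₂ e with oriented-kind (dvE-kind _ _ e)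
    ...   | inj₁ (z , s) = inj₁ (z , SameEdge-reverse s)
    ...   | inj₂ (T , s) = inj₂ (T , SameEdge-reverse s)

lemma57 : (G : Graph) → (n m : ℕ) → G ≅ DoubleVasePlusIsolated n m → LineBNice G
lemma57 G n m iso =
  4 + n , lineCliqueNumber , aliceWinsB , λ k k<4+n → Game.star⇒¬AliceWinsB G spokes k<4+n
  where
  open Vase.Shape G (Labelled.doubleVase iso)
  open Vase.Strategy G (Labelled.doubleVase iso)
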